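{- Let $n\ge2$. If there exists a pair of quasi-unbiased Hadamard matrices of order $n$ with parameters $(l,a)$, then $l=\big(\frac{n}{2\alpha}\big)^2$ and $a=4\alpha^2$ for some positive integer $\alpha$ satisfying $n\equiv0\pmod{2\alpha}$ and $n\le4\alpha^2$.
   Context: A Hadamard matrix of order $n$ is an $n\times n$ $(\pm1)$-matrix $H$ with $HH^T=nI_n$ (so $n\in\{1,2\}$ or $4\mid n$). A weighing matrix of order $n$ and weight $k$ is an $n\times n$ $(1,-1,0)$-matrix $W$ with $WW^T=kI_n$. Hadamard matrices $H,K$ of order $n$ are quasi-unbiased with parameters $(l,a)$ if $\frac1{\sqrt a}HK^T$ is a weighing matrix of weight $l$. -}

module Defs where

open import Data.Nat as ℕ using (ℕ)
open import Data.Fin using (Fin; zero; suc; _≟_)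
open import Data.Product using (_×_)
open import Relation.Nullary using (yes; no)
open import Data.Integer using (ℤ; +_; -[1+_]; _+_; _*_; -_)
open import Relation.Binary.PropositionalEquality using (_≡_)
open import Data.Sum using (_⊎_)

Mat : ℕ → Set
Mat n = Fin n → Fin n → ℤ

sumFin : ∀ n → (Fin n → ℤ) → ℤ
sumFin ℕ.zero f = + 0
sumFin (ℕ.suc n) f = f zero + sumFin n (λ k → f (suc k))

_ᵀ : ∀ {n} → Mat n → Mat n
(M ᵀ) i j = M j i

_⊗_ : ∀ {n} → Mat n → Mat n → Mat n
_⊗_ {n} A B i j = sumFin n (λ k → A i k * B k j)

scalarId : ∀ {n} → ℤ → Mat n
scalarId c i j with i ≟ j
... | yes _ = c
... | no  _ = + 0

IsHadamard : ∀ n → Mat n → Set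
IsHadamard n H = (∀ i j → H i j ≡ + 1 ⊎ H i j ≡ -[1+ 0 ])
               × (∀ i j → (H ⊗ (H ᵀ)) i j ≡ scalarId (+ n) i j)

IsWeighing : ∀ n → ℕ → Mat n → Set
IsWeighing n k W = (∀ i j → W i j ≡ + 1 ⊎ W i j ≡ + 0 ⊎ W i j ≡ -[1+ 0 ])
                 × (∀ i j → (W ⊗ (W ᵀ)) i j ≡ scalarId (+ k) i j)

-- H, K quasi-unbiased with parameters (l, a), a > 0:  (1/√a) H Kᵀ is a
-- weighing matrix of weight l.  Avoiding reals, with M = H Kᵀ this says
-- literally: every entry of M is 0 or ±√a (i.e. its square is 0 or a), and
-- (1/√a)M ((1/√a)M)ᵀ = l I, i.e. M Mᵀ = (a·l) I.
QuasiUnbiased : ∀ n → ℕ → ℕ → Mat n → Mat n → Set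
QuasiUnbiased n l a H K =
    (0 ℕ.< a)
  × (∀ i j → ((H ⊗ (K ᵀ)) i j * (H ⊗ (K ᵀ)) i j ≡ + 0)
           ⊎ ((H ⊗ (K ᵀ)) i j * (H ⊗ (K ᵀ)) i j ≡ + a))
  × (∀ i j → ((H ⊗ (K ᵀ)) ⊗ ((H ⊗ (K ᵀ)) ᵀ)) i j ≡ scalarId (+ (a ℕ.* l)) i j)

-- Put M = H Kᵀ. Over ℤ, K Kᵀ = n I forces Kᵀ K = n I, hence M Mᵀ = n² I and a l = n².
-- The squares of the entries of a row of M are 0 or a and add up to n², so n ≤ a and some
-- entry m has m² = a. An entry of a product of ±1 matrices is congruent to n mod 2, and n is
-- even since two rows of H are orthogonal; so m = 2α, a = 4α², and l (2α)² = n² gives 2α ∣ n.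

module Submission where

open import Data.Empty using (⊥-elim)
open import Data.Fin using (Fin; zero; suc; _≟_)
open import Data.Product using (_×_; ∃; _,_; proj₁; proj₂)
open import Data.Sum using (_⊎_; inj₁; inj₂; reduce)
open import Function using (_∘_)
open import Level using (0ℓ)
open import Relation.Binary.Bundles using (Setoid)
open import Relation.Binary.PropositionalEquality
  using (_≡_; _≢_; refl; sym; trans; cong; cong₂; subst; subst₂; module ≡-Reasoning)
open import Relation.Nullary using (yes; no)
open import Defs

module IntegerMatrices where

  open import Data.Integer
    using (ℤ; +_; -[1+_]; 0ℤ; _+_; _*_; -_; _-_; _≤_; +≤+; ∣_∣)
  open import Data.Integer.Properties hiding (_≟_)
  open import Data.Integer.Properties using () renaming (_≟_ to _≟ℤ_)
  open import Data.Integer.Tactic.RingSolver using (solve-∀)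
  open import Algebra.Properties.Semiring.Sum +-*-semiring
    using (sum; sum-syntax; sum-cong-≗; sum-replicate-zero; ∑-distrib-+; ∑-comm;
           *-distribˡ-sum; *-distribʳ-sum)
  import Data.Nat as ℕ
  import Data.Nat.Properties as ℕ
  open import Data.Nat.Divisibility using (_∣_; divides)

  sumFin≡sum : ∀ n (f : Fin n → ℤ) → sumFin n f ≡ sum f
  sumFin≡sum ℕ.zero    f = refl
  sumFin≡sum (ℕ.suc n) f = cong (λ s → f zero + s) (sumFin≡sum n (f ∘ suc))

  ⊗-entry : ∀ {n} (A B : Mat n) i j → (A ⊗ B) i j ≡ ∑[ k < n ] (A i k * B k j)
  ⊗-entry {n} A B i j = sumFin≡sum n (λ k → A i k * B k j)

  sum-const : ∀ n c → ∑[ k < n ] c ≡ + n * c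
  sum-const ℕ.zero    c = sym (*-zeroˡ c)
  sum-const (ℕ.suc n) c = trans (cong (λ s → c + s) (sum-const n c)) (distrib c (+ n))
    where
    distrib : ∀ c m → c + m * c ≡ (+ 1 + m) * c
    distrib = solve-∀

  scalarId-diag : ∀ {n} c (i : Fin n) → scalarId c i i ≡ c
  scalarId-diag c i with i ≟ i
  ... | yes _  = refl
  ... | no i≢i = ⊥-elim (i≢i refl)

  scalarId-suc : ∀ {n} c (i j : Fin n) → scalarId c (suc i) (suc j) ≡ scalarId c i j
  scalarId-suc c i j with i ≟ j
  ... | yes refl = refl
  ... | no _     = refl

  sum-scalarIdˡ : ∀ {n} c (i : Fin n) (f : Fin n → ℤ) →
                  ∑[ k < n ] (scalarId c i k * f k) ≡ c * f i
  sum-scalarIdˡ {ℕ.suc n} c zero f = begin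
    c * f zero + ∑[ k < n ] (0ℤ * f (suc k))  ≡⟨ cong (λ s → c * f zero + s) (sum-replicate-zero n) ⟩
    c * f zero + 0ℤ                           ≡⟨ +-identityʳ _ ⟩
    c * f zero                                ∎
    where open ≡-Reasoning
  sum-scalarIdˡ {ℕ.suc n} c (suc i) f = begin
    0ℤ + ∑[ k < n ] (scalarId c (suc i) (suc k) * f (suc k))
      ≡⟨ +-identityˡ _ ⟩
    ∑[ k < n ] (scalarId c (suc i) (suc k) * f (suc k))
      ≡⟨ sum-cong-≗ (λ k → cong (_* f (suc k)) (scalarId-suc c i k)) ⟩
    ∑[ k < n ] (scalarId c i k * f (suc k))
      ≡⟨ sum-scalarIdˡ c i (f ∘ suc) ⟩
    c * f (suc i)
      ∎
    where open ≡-Reasoning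

  infix 4 _≈_
  _≈_ : ∀ {n} → Mat n → Mat n → Set
  A ≈ B = ∀ i j → A i j ≡ B i j

  ≈-setoid : ℕ.ℕ → Setoid 0ℓ 0ℓ
  ≈-setoid n = record
    { Carrier       = Mat n
    ; _≈_           = _≈_
    ; isEquivalence = record
      { refl  = λ i j → refl
      ; sym   = λ A≈B i j → sym (A≈B i j)
      ; trans = λ A≈B B≈C i j → trans (A≈B i j) (B≈C i j)
      }
    }

  infixr 7 _·_
  _·_ : ∀ {n} → ℤ → Mat n → Mat n
  (c · A) i j = c * A i j

  trace : ∀ {n} → Mat n → ℤ
  trace {n} A = ∑[ i < n ] A i i

  ⊗-cong : ∀ {n} {A A′ B B′ : Mat n} → A ≈ A′ → B ≈ B′ → A ⊗ B ≈ A′ ⊗ B′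
  ⊗-cong {A = A} {A′} {B} {B′} A≈A′ B≈B′ i j = begin
    (A ⊗ B) i j                  ≡⟨ ⊗-entry A B i j ⟩
    ∑[ k < _ ] (A i k * B k j)    ≡⟨ sum-cong-≗ (λ k → cong₂ _*_ (A≈A′ i k) (B≈B′ k j)) ⟩
    ∑[ k < _ ] (A′ i k * B′ k j)  ≡⟨ ⊗-entry A′ B′ i j ⟨
    (A′ ⊗ B′) i j                ∎
    where open ≡-Reasoning

  ⊗-congˡ : ∀ {n} (A : Mat n) {B B′} → B ≈ B′ → A ⊗ B ≈ A ⊗ B′
  ⊗-congˡ A = ⊗-cong {A = A} (λ i j → refl)

  ⊗-congʳ : ∀ {n} (B : Mat n) {A A′} → A ≈ A′ → A ⊗ B ≈ A′ ⊗ B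
  ⊗-congʳ B A≈A′ = ⊗-cong {B = B} A≈A′ (λ i j → refl)

  ⊗-assoc : ∀ {n} (A B C : Mat n) → (A ⊗ B) ⊗ C ≈ A ⊗ (B ⊗ C)
  ⊗-assoc {n} A B C i j = begin
    ((A ⊗ B) ⊗ C) i j
      ≡⟨ ⊗-entry (A ⊗ B) C i j ⟩
    ∑[ m < n ] ((A ⊗ B) i m * C m j)
      ≡⟨ sum-cong-≗ (λ m → cong (_* C m j) (⊗-entry A B i m)) ⟩
    ∑[ m < n ] (∑[ k < n ] (A i k * B k m) * C m j)
      ≡⟨ sum-cong-≗ (λ m → *-distribʳ-sum (C m j) (λ k → A i k * B k m)) ⟩
    ∑[ m < n ] ∑[ k < n ] (A i k * B k m * C m j)
      ≡⟨ ∑-comm (λ m k → A i k * B k m * C m j) ⟩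
    ∑[ k < n ] ∑[ m < n ] (A i k * B k m * C m j)
      ≡⟨ sum-cong-≗ (λ k → sum-cong-≗ (λ m → *-assoc (A i k) (B k m) (C m j))) ⟩
    ∑[ k < n ] ∑[ m < n ] (A i k * (B k m * C m j))
      ≡⟨ sum-cong-≗ (λ k → *-distribˡ-sum (A i k) (λ m → B k m * C m j)) ⟨
    ∑[ k < n ] (A i k * ∑[ m < n ] (B k m * C m j))
      ≡⟨ sum-cong-≗ (λ k → cong (A i k *_) (⊗-entry B C k j)) ⟨
    ∑[ k < n ] (A i k * (B ⊗ C) k j)
      ≡⟨ ⊗-entry A (B ⊗ C) i j ⟨
    (A ⊗ (B ⊗ C)) i j
      ∎
    where open ≡-Reasoning

  ᵀ-⊗ : ∀ {n} (A B : Mat n) → (A ⊗ B) ᵀ ≈ (B ᵀ) ⊗ (A ᵀ)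
  ᵀ-⊗ {n} A B i j = begin
    (A ⊗ B) j i                ≡⟨ ⊗-entry A B j i ⟩
    ∑[ k < n ] (A j k * B k i)  ≡⟨ sum-cong-≗ (λ k → *-comm (A j k) (B k i)) ⟩
    ∑[ k < n ] (B k i * A j k)  ≡⟨ ⊗-entry (B ᵀ) (A ᵀ) i j ⟨
    ((B ᵀ) ⊗ (A ᵀ)) i j            ∎
    where open ≡-Reasoning

  scalarId-⊗ : ∀ {n} c (A : Mat n) → scalarId c ⊗ A ≈ c · A
  scalarId-⊗ c A i j = trans (⊗-entry (scalarId c) A i j) (sum-scalarIdˡ c i (λ k → A k j))

  ⊗-·ʳ : ∀ {n} c (A B : Mat n) → A ⊗ (c · B) ≈ c · (A ⊗ B)
  ⊗-·ʳ {n} c A B i j = begin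
    (A ⊗ (c · B)) i j              ≡⟨ ⊗-entry A (c · B) i j ⟩
    ∑[ k < n ] (A i k * (c * B k j)) ≡⟨ sum-cong-≗ (λ k → swap (A i k) c (B k j)) ⟩
    ∑[ k < n ] (c * (A i k * B k j)) ≡⟨ *-distribˡ-sum c (λ k → A i k * B k j) ⟨
    c * ∑[ k < n ] (A i k * B k j)   ≡⟨ cong (c *_) (⊗-entry A B i j) ⟨
    c * (A ⊗ B) i j                ∎
    where
    open ≡-Reasoning
    swap : ∀ x c y → x * (c * y) ≡ c * (x * y)
    swap = solve-∀

  ·-congˡ : ∀ {n} c {A B : Mat n} → A ≈ B → c · A ≈ c · B
  ·-congˡ c A≈B i j = cong (c *_) (A≈B i j)

  ·-scalarId : ∀ {n} c d → c · scalarId {n} d ≈ scalarId (c * d)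
  ·-scalarId c d i j with i ≟ j
  ... | yes _ = refl
  ... | no  _ = *-zeroʳ c

  trace-⊗-comm : ∀ {n} (A B : Mat n) → trace (A ⊗ B) ≡ trace (B ⊗ A)
  trace-⊗-comm {n} A B = begin
    ∑[ i < n ] (A ⊗ B) i i                ≡⟨ sum-cong-≗ (λ i → ⊗-entry A B i i) ⟩
    ∑[ i < n ] ∑[ k < n ] (A i k * B k i)  ≡⟨ ∑-comm (λ i k → A i k * B k i) ⟩
    ∑[ k < n ] ∑[ i < n ] (A i k * B k i)  ≡⟨ sum-cong-≗ (λ k → sum-cong-≗ (λ i → *-comm (A i k) (B k i))) ⟩
    ∑[ k < n ] ∑[ i < n ] (B k i * A i k)  ≡⟨ sum-cong-≗ (λ k → ⊗-entry B A k k) ⟨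
    ∑[ k < n ] (B ⊗ A) k k                ∎
    where open ≡-Reasoning

  trace-scalarId : ∀ {n} c → trace (scalarId {n} c) ≡ + n * c
  trace-scalarId {n} c = trans (sum-cong-≗ {n} (λ i → scalarId-diag c i)) (sum-const n c)

  i*i≡+∣i∣*∣i∣ : ∀ i → i * i ≡ + (∣ i ∣ ℕ.* ∣ i ∣)
  i*i≡+∣i∣*∣i∣ (+ m)    = sym (pos-* m m)
  i*i≡+∣i∣*∣i∣ -[1+ m ] = refl

  0≤i*i : ∀ i → 0ℤ ≤ i * i
  0≤i*i i = subst (0ℤ ≤_) (sym (i*i≡+∣i∣*∣i∣ i)) (+≤+ ℕ.z≤n)

  i*i≡0⇒i≡0 : ∀ i → i * i ≡ 0ℤ → i ≡ 0ℤ
  i*i≡0⇒i≡0 i i*i≡0 = reduce (i*j≡0⇒i≡0∨j≡0 i i*i≡0)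

  sum-mono-≤ : ∀ {n} {f g : Fin n → ℤ} → (∀ k → f k ≤ g k) → sum f ≤ sum g
  sum-mono-≤ {ℕ.zero}  f≤g = ≤-refl
  sum-mono-≤ {ℕ.suc n} f≤g = +-mono-≤ (f≤g zero) (sum-mono-≤ (f≤g ∘ suc))

  sum-≤ : ∀ {n} (f : Fin n → ℤ) c → (∀ k → f k ≤ c) → sum f ≤ + n * c
  sum-≤ {n} f c f≤c = subst (sum f ≤_) (sum-const n c) (sum-mono-≤ f≤c)

  sum-nonneg : ∀ {n} (f : Fin n → ℤ) → (∀ k → 0ℤ ≤ f k) → 0ℤ ≤ sum f
  sum-nonneg {n} f 0≤f = subst (_≤ sum f) (sum-replicate-zero n) (sum-mono-≤ 0≤f)

  sum-≢0⇒∃≢0 : ∀ {n} (f : Fin n → ℤ) → sum f ≢ 0ℤ → ∃ λ k → f k ≢ 0ℤ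
  sum-≢0⇒∃≢0 {ℕ.zero}  f ∑f≢0 = ⊥-elim (∑f≢0 refl)
  sum-≢0⇒∃≢0 {ℕ.suc n} f ∑f≢0 with f zero ≟ℤ 0ℤ
  ... | no  f₀≢0 = zero , f₀≢0
  ... | yes f₀≡0 with sum-≢0⇒∃≢0 (f ∘ suc) (λ ∑tail≡0 → ∑f≢0 (cong₂ _+_ f₀≡0 ∑tail≡0))
  ...   | k , fk≢0 = suc k , fk≢0

  i+j≡0⇒i≡0 : ∀ {i j} → 0ℤ ≤ i → 0ℤ ≤ j → i + j ≡ 0ℤ → i ≡ 0ℤ
  i+j≡0⇒i≡0 {i} 0≤i 0≤j i+j≡0 =
    ≤-antisym (subst₂ _≤_ (+-identityʳ i) i+j≡0 (+-monoʳ-≤ i 0≤j)) 0≤i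

  sum-nonneg≡0 : ∀ {n} (f : Fin n → ℤ) → (∀ k → 0ℤ ≤ f k) → sum f ≡ 0ℤ → ∀ k → f k ≡ 0ℤ
  sum-nonneg≡0 {ℕ.suc n} f 0≤f ∑f≡0 zero =
    i+j≡0⇒i≡0 (0≤f zero) (sum-nonneg (f ∘ suc) (0≤f ∘ suc)) ∑f≡0
  sum-nonneg≡0 {ℕ.suc n} f 0≤f ∑f≡0 (suc k) =
    sum-nonneg≡0 (f ∘ suc) (0≤f ∘ suc)
      (i+j≡0⇒i≡0 (sum-nonneg (f ∘ suc) (0≤f ∘ suc)) (0≤f zero)
        (trans (+-comm (sum (f ∘ suc)) (f zero)) ∑f≡0)) k

  sum-squares≡0 : ∀ {n} (D : Mat n) → ∑[ i < n ] ∑[ j < n ] (D i j * D i j) ≡ 0ℤ →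
                  ∀ i j → D i j ≡ 0ℤ
  sum-squares≡0 D ∑D²≡0 i j =
    i*i≡0⇒i≡0 (D i j)
      (sum-nonneg≡0 (λ j → D i j * D i j) (λ j → 0≤i*i (D i j))
        (sum-nonneg≡0 (λ i → ∑[ j < _ ] (D i j * D i j))
          (λ i → sum-nonneg (λ j → D i j * D i j) (λ j → 0≤i*i (D i j))) ∑D²≡0 i) j)

  sum-sq-sub-scalarId : ∀ {n} (A : Mat n) c i →
    ∑[ j < n ] ((A i j - scalarId c i j) * (A i j - scalarId c i j))
      ≡ (A ⊗ (A ᵀ)) i i + (- + 2 * (c * A i i) + c * c)
  sum-sq-sub-scalarId {n} A c i = begin
    ∑[ j < n ] ((a j - δ j) * (a j - δ j))
      ≡⟨ sum-cong-≗ (λ j → expand (a j) (δ j)) ⟩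
    ∑[ j < n ] (a j * a j + (- + 2 * (δ j * a j) + δ j * δ j))
      ≡⟨ ∑-distrib-+ (λ j → a j * a j) _ ⟩
    ∑[ j < n ] (a j * a j) + ∑[ j < n ] (- + 2 * (δ j * a j) + δ j * δ j)
      ≡⟨ cong (λ s → ∑[ j < n ] (a j * a j) + s) (∑-distrib-+ (λ j → - + 2 * (δ j * a j)) _) ⟩
    ∑[ j < n ] (a j * a j) + (∑[ j < n ] (- + 2 * (δ j * a j)) + ∑[ j < n ] (δ j * δ j))
      ≡⟨ cong₂ (λ s t → ∑[ j < n ] (a j * a j) + (s + t))
           (trans (sym (*-distribˡ-sum (- + 2) (λ j → δ j * a j))) (cong (- + 2 *_) (sum-scalarIdˡ c i a)))
           (trans (sum-scalarIdˡ c i δ) (cong (c *_) (scalarId-diag c i))) ⟩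
    ∑[ j < n ] (a j * a j) + (- + 2 * (c * a i) + c * c)
      ≡⟨ cong (λ s → s + (- + 2 * (c * a i) + c * c)) (⊗-entry A (A ᵀ) i i) ⟨
    (A ⊗ (A ᵀ)) i i + (- + 2 * (c * A i i) + c * c)
      ∎
    where
    open ≡-Reasoning
    a δ : Fin n → ℤ
    a = A i
    δ = scalarId c i
    expand : ∀ x d → (x - d) * (x - d) ≡ x * x + (- + 2 * (d * x) + d * d)
    expand = solve-∀

  -- With G = Kᵀ K one has G² = c G and tr G = n c, so Σᵢⱼ (G - c I)ᵢⱼ² = 0.
  ⊗ᵀ≈scalarId⇒ᵀ⊗≈scalarId : ∀ {n} (K : Mat n) c →
    K ⊗ (K ᵀ) ≈ scalarId c → (K ᵀ) ⊗ K ≈ scalarId c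
  ⊗ᵀ≈scalarId⇒ᵀ⊗≈scalarId {n} K c KKᵀ≈cI i j =
    i-j≡0⇒i≡j (G i j) (scalarId c i j) (sum-squares≡0 D ∑D²≡0 i j)
    where
    G D : Mat n
    G = (K ᵀ) ⊗ K
    D i j = G i j - scalarId c i j

    G²≈cG : G ⊗ G ≈ c · G
    G²≈cG = begin
      ((K ᵀ) ⊗ K) ⊗ ((K ᵀ) ⊗ K)  ≈⟨ ⊗-assoc (K ᵀ) K G ⟩
      (K ᵀ) ⊗ (K ⊗ G)           ≈⟨ ⊗-congˡ (K ᵀ) (⊗-assoc K (K ᵀ) K) ⟨
      (K ᵀ) ⊗ ((K ⊗ (K ᵀ)) ⊗ K)  ≈⟨ ⊗-congˡ (K ᵀ) (⊗-congʳ K KKᵀ≈cI) ⟩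
      (K ᵀ) ⊗ (scalarId c ⊗ K)   ≈⟨ ⊗-congˡ (K ᵀ) (scalarId-⊗ c K) ⟩
      (K ᵀ) ⊗ (c · K)            ≈⟨ ⊗-·ʳ c (K ᵀ) K ⟩
      c · G                     ∎
      where open import Relation.Binary.Reasoning.Setoid (≈-setoid n)

    GGᵀ≈cG : G ⊗ (G ᵀ) ≈ c · G
    GGᵀ≈cG i j = trans (⊗-congˡ G (ᵀ-⊗ (K ᵀ) K) i j) (G²≈cG i j)

    trace-G : trace G ≡ + n * c
    trace-G = trans (trace-⊗-comm (K ᵀ) K)
                    (trans (sum-cong-≗ {n} (λ i → KKᵀ≈cI i i)) (trace-scalarId {n} c))

    ∑D²≡0 : ∑[ i < n ] ∑[ j < n ] (D i j * D i j) ≡ 0ℤ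
    ∑D²≡0 = begin
      ∑[ i < n ] ∑[ j < n ] (D i j * D i j)
        ≡⟨ sum-cong-≗ (sum-sq-sub-scalarId G c) ⟩
      ∑[ i < n ] ((G ⊗ (G ᵀ)) i i + (- + 2 * (c * G i i) + c * c))
        ≡⟨ sum-cong-≗ (λ i → cong (λ x → x + (- + 2 * (c * G i i) + c * c)) (GGᵀ≈cG i i)) ⟩
      ∑[ i < n ] (c * G i i + (- + 2 * (c * G i i) + c * c))
        ≡⟨ sum-cong-≗ (λ i → collect c (G i i)) ⟩
      ∑[ i < n ] (c * c + - c * G i i)
        ≡⟨ ∑-distrib-+ (λ _ → c * c) (λ i → - c * G i i) ⟩
      ∑[ i < n ] (c * c) + ∑[ i < n ] (- c * G i i)
        ≡⟨ cong₂ _+_ (sum-const n (c * c)) (sym (*-distribˡ-sum (- c) (λ i → G i i))) ⟩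
      + n * (c * c) + - c * trace G
        ≡⟨ cong (λ t → + n * (c * c) + - c * t) trace-G ⟩
      + n * (c * c) + - c * (+ n * c)
        ≡⟨ cancel (+ n) c ⟩
      0ℤ
        ∎
      where
      open ≡-Reasoning
      collect : ∀ c g → c * g + (- + 2 * (c * g) + c * c) ≡ c * c + - c * g
      collect = solve-∀
      cancel : ∀ m c → m * (c * c) + - c * (m * c) ≡ 0ℤ
      cancel = solve-∀

  ⊗ᵀ-product : ∀ {n} (A B : Mat n) c d → A ⊗ (A ᵀ) ≈ scalarId c → B ⊗ (B ᵀ) ≈ scalarId d →
               (A ⊗ (B ᵀ)) ⊗ ((A ⊗ (B ᵀ)) ᵀ) ≈ scalarId (d * c)
  ⊗ᵀ-product {n} A B c d AAᵀ≈cI BBᵀ≈dI = begin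
    (A ⊗ (B ᵀ)) ⊗ ((A ⊗ (B ᵀ)) ᵀ)  ≈⟨ ⊗-congˡ (A ⊗ (B ᵀ)) (ᵀ-⊗ A (B ᵀ)) ⟩
    (A ⊗ (B ᵀ)) ⊗ (B ⊗ (A ᵀ))      ≈⟨ ⊗-assoc A (B ᵀ) (B ⊗ (A ᵀ)) ⟩
    A ⊗ ((B ᵀ) ⊗ (B ⊗ (A ᵀ)))      ≈⟨ ⊗-congˡ A (⊗-assoc (B ᵀ) B (A ᵀ)) ⟨
    A ⊗ (((B ᵀ) ⊗ B) ⊗ (A ᵀ))      ≈⟨ ⊗-congˡ A (⊗-congʳ (A ᵀ) (⊗ᵀ≈scalarId⇒ᵀ⊗≈scalarId B d BBᵀ≈dI)) ⟩
    A ⊗ (scalarId d ⊗ (A ᵀ))       ≈⟨ ⊗-congˡ A (scalarId-⊗ d (A ᵀ)) ⟩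
    A ⊗ (d · (A ᵀ))                ≈⟨ ⊗-·ʳ d A (A ᵀ) ⟩
    d · (A ⊗ (A ᵀ))                ≈⟨ ·-congˡ d AAᵀ≈cI ⟩
    d · scalarId c                 ≈⟨ ·-scalarId d c ⟩
    scalarId (d * c)               ∎
    where open import Relation.Binary.Reasoning.Setoid (≈-setoid n)

  IsSign : ℤ → Set
  IsSign x = x ≡ + 1 ⊎ x ≡ -[1+ 0 ]

  IsSign-* : ∀ {x y} → IsSign x → IsSign y → IsSign (x * y)
  IsSign-* (inj₁ refl) (inj₁ refl) = inj₁ refl
  IsSign-* (inj₁ refl) (inj₂ refl) = inj₂ refl
  IsSign-* (inj₂ refl) (inj₁ refl) = inj₂ refl
  IsSign-* (inj₂ refl) (inj₂ refl) = inj₁ refl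

  -- p counts the entries equal to + 1.
  sum-signs-parity : ∀ {n} (f : Fin n → ℤ) → (∀ k → IsSign (f k)) →
                     ∃ λ p → sum f + + n ≡ + (2 ℕ.* p)
  sum-signs-parity {ℕ.zero}  f _ = 0 , refl
  sum-signs-parity {ℕ.suc n} f ±f = step (±f zero) (sum-signs-parity (f ∘ suc) (±f ∘ suc))
    where
    regroup : ∀ x s m → (x + s) + (+ 1 + m) ≡ (x + + 1) + (s + m)
    regroup = solve-∀

    step : IsSign (f zero) → ∃ (λ p → sum (f ∘ suc) + + n ≡ + (2 ℕ.* p)) →
           ∃ λ p → sum f + + ℕ.suc n ≡ + (2 ℕ.* p)
    step (inj₁ f₀≡1) (p , eq) = ℕ.suc p , (begin
      sum f + + ℕ.suc n                          ≡⟨ regroup (f zero) (sum (f ∘ suc)) (+ n) ⟩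
      (f zero + + 1) + (sum (f ∘ suc) + + n)     ≡⟨ cong₂ (λ x y → (x + + 1) + y) f₀≡1 eq ⟩
      + (2 ℕ.+ 2 ℕ.* p)                          ≡⟨ cong +_ (ℕ.*-suc 2 p) ⟨
      + (2 ℕ.* ℕ.suc p)                          ∎)
      where open ≡-Reasoning
    step (inj₂ f₀≡-1) (p , eq) =
      p , trans (regroup (f zero) (sum (f ∘ suc)) (+ n)) (cong₂ (λ x y → (x + + 1) + y) f₀≡-1 eq)

  IsSignMatrix : ∀ {n} → Mat n → Set
  IsSignMatrix A = ∀ i j → IsSign (A i j)

  ⊗ᵀ-parity : ∀ {n} {A B : Mat n} → IsSignMatrix A → IsSignMatrix B →
              ∀ i j → ∃ λ p → (A ⊗ (B ᵀ)) i j + + n ≡ + (2 ℕ.* p)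
  ⊗ᵀ-parity {n} {A} {B} ±A ±B i j
    with sum-signs-parity (λ k → A i k * B j k) (λ k → IsSign-* (±A i k) (±B j k))
  ... | p , eq = p , trans (cong (λ x → x + + n) (⊗-entry A (B ᵀ) i j)) eq

  ⊗ᵀ-even : ∀ {n} {A B : Mat n} → 2 ∣ n → IsSignMatrix A → IsSignMatrix B →
            ∀ i j → ∃ λ d → (A ⊗ (B ᵀ)) i j ≡ + 2 * d
  ⊗ᵀ-even {n} {A} {B} (divides p n≡p*2) ±A ±B i j with ⊗ᵀ-parity ±A ±B i j
  ... | q , eq = + q - + p , (begin
    m                          ≡⟨ shift m (+ n) ⟩
    (m + + n) - + n            ≡⟨ cong₂ _-_ eq (cong +_ n≡p*2) ⟩
    + (2 ℕ.* q) - + (p ℕ.* 2)  ≡⟨ cong₂ _-_ (pos-* 2 q) (pos-* p 2) ⟩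
    + 2 * + q - + p * + 2      ≡⟨ factor (+ q) (+ p) ⟩
    + 2 * (+ q - + p)          ∎)
    where
    open ≡-Reasoning
    m : ℤ
    m = (A ⊗ (B ᵀ)) i j
    shift : ∀ x y → x ≡ (x + y) - y
    shift = solve-∀
    factor : ∀ x y → + 2 * x - y * + 2 ≡ + 2 * (x - y)
    factor = solve-∀

  square-of-even : ∀ {m d a} → m ≡ + 2 * d → m * m ≡ + a → a ≡ 4 ℕ.* (∣ d ∣ ℕ.* ∣ d ∣)
  square-of-even {m} {d} {a} m≡2d m²≡a = +-injective (begin
    + a                        ≡⟨ m²≡a ⟨
    m * m                      ≡⟨ cong₂ _*_ m≡2d m≡2d ⟩
    (+ 2 * d) * (+ 2 * d)      ≡⟨ square-2* d ⟩
    + 4 * (d * d)              ≡⟨ cong (+ 4 *_) (i*i≡+∣i∣*∣i∣ d) ⟩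
    + 4 * + (∣ d ∣ ℕ.* ∣ d ∣)  ≡⟨ pos-* 4 (∣ d ∣ ℕ.* ∣ d ∣) ⟨
    + (4 ℕ.* (∣ d ∣ ℕ.* ∣ d ∣)) ∎)
    where
    open ≡-Reasoning
    square-2* : ∀ x → (+ 2 * x) * (+ 2 * x) ≡ + 4 * (x * x)
    square-2* = solve-∀

  sum-squares-twoValued : ∀ {n} (m : Fin (ℕ.suc n) → ℤ) a →
    (∀ j → m j * m j ≡ 0ℤ ⊎ m j * m j ≡ + a) →
    ∑[ j < ℕ.suc n ] (m j * m j) ≡ + (ℕ.suc n ℕ.* ℕ.suc n) →
    ℕ.suc n ℕ.≤ a × ∃ λ j → m j * m j ≡ + a
  sum-squares-twoValued {n} m a m²∈0a ∑m²≡N² = N≤a , j , m²≡a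
    where
    N : ℕ.ℕ
    N = ℕ.suc n
    m² : Fin N → ℤ
    m² j = m j * m j
    m²≤a : ∀ j → m² j ≤ + a
    m²≤a j with m²∈0a j
    ... | inj₁ m²≡0 = subst (_≤ + a) (sym m²≡0) (+≤+ ℕ.z≤n)
    ... | inj₂ m²≡a = ≤-reflexive m²≡a
    N≤a : N ℕ.≤ a
    N≤a = ℕ.*-cancelˡ-≤ N (drop‿+≤+ (subst₂ _≤_ ∑m²≡N² (sym (pos-* N a)) (sum-≤ m² (+ a) m²≤a)))
    nonzero : ∃ λ j → m² j ≢ 0ℤ
    nonzero = sum-≢0⇒∃≢0 m² (λ ∑m²≡0 → ℕ.1+n≢0 (+-injective (trans (sym ∑m²≡N²) ∑m²≡0)))
    j : Fin N
    j = proj₁ nonzero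
    m²≡a : m² j ≡ + a
    m²≡a with m²∈0a j
    ... | inj₁ m²≡0 = ⊥-elim (proj₂ nonzero m²≡0)
    ... | inj₂ m²≡a = m²≡a

module HadamardPairs where

  open IntegerMatrices
  open import Data.Integer using (+_; _+_; _*_; ∣_∣)
  open import Data.Integer.Properties using (+-injective; pos-*; +-*-semiring)
  open import Algebra.Properties.Semiring.Sum +-*-semiring using (sum-syntax)
  open import Data.Nat as ℕ using (ℕ; _≤_)
  import Data.Nat.Properties as ℕ
  open import Data.Nat.Divisibility using (_∣_; divides)

  hadamard-order-even : ∀ {n} {H : Mat (ℕ.suc (ℕ.suc n))} →
                        IsHadamard (ℕ.suc (ℕ.suc n)) H → 2 ∣ ℕ.suc (ℕ.suc n)
  hadamard-order-even {n} (±H , HHᵀ≈nI) with ⊗ᵀ-parity ±H ±H zero (suc zero)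
  ... | p , eq = divides p (trans (+-injective N≡2p) (ℕ.*-comm 2 p))
    where
    N≡2p : + ℕ.suc (ℕ.suc n) ≡ + (2 ℕ.* p)
    N≡2p = trans (cong (λ x → x + + ℕ.suc (ℕ.suc n)) (sym (HHᵀ≈nI zero (suc zero)))) eq

  quasiUnbiased-params : ∀ n {l a} {H K : Mat (ℕ.suc (ℕ.suc n))} → let N = ℕ.suc (ℕ.suc n) in
    IsHadamard N H → IsHadamard N K → QuasiUnbiased N l a H K →
    a ℕ.* l ≡ N ℕ.* N × N ≤ a × ∃ λ α → a ≡ 4 ℕ.* (α ℕ.* α)
  quasiUnbiased-params n {l} {a} {H} {K} hadH@(±H , HHᵀ≈NI) (±K , KKᵀ≈NI) (_ , M²∈0a , MMᵀ≈alI) =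
    let N≤a , j , M₀ⱼ²≡a = sum-squares-twoValued (M zero) a (M²∈0a zero) ∑M₀²≡N²
        d , M₀ⱼ≡2d       = ⊗ᵀ-even (hadamard-order-even hadH) ±H ±K zero j
    in  al≡N² , N≤a , ∣ d ∣ , square-of-even M₀ⱼ≡2d M₀ⱼ²≡a
    where
    N : ℕ
    N = ℕ.suc (ℕ.suc n)
    M : Mat N
    M = H ⊗ (K ᵀ)
    al≡N² : a ℕ.* l ≡ N ℕ.* N
    al≡N² = +-injective (trans (sym (MMᵀ≈alI zero zero))
              (trans (⊗ᵀ-product H K (+ N) (+ N) HHᵀ≈NI KKᵀ≈NI zero zero) (sym (pos-* N N))))
    ∑M₀²≡N² : ∑[ j < N ] (M zero j * M zero j) ≡ + (N ℕ.* N)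
    ∑M₀²≡N² = trans (sym (⊗-entry M (M ᵀ) zero zero)) (trans (MMᵀ≈alI zero zero) (cong +_ al≡N²))

module SquareDivisibility where

  open import Data.Nat
  open import Data.Nat.Properties
  open import Data.Nat.Divisibility
  open import Data.Nat.GCD using (gcd; GCD; gcd[m,n]∣m; gcd[m,n]∣n; gcd[m,n]≢0; gcd-GCD; GCD-*)
  open import Data.Nat.Coprimality using (Coprime; GCD≡1⇒coprime; coprime-divisor)
  open import Data.Nat.Tactic.RingSolver using (solve-∀)

  square : ∀ m → m ^ 2 ≡ m * m
  square m = cong (m *_) (*-identityʳ m)

  m*m∣n*n⇒m∣n : ∀ m n → m * m ∣ n * n → m ∣ n
  m*m∣n*n⇒m∣n zero n 0∣n*n = subst (0 ∣_) (sym (reduce (m*n≡0⇒m≡0∨n≡0 n (0∣⇒≡0 0∣n*n)))) ∣-refl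
  m*m∣n*n⇒m∣n m@(suc _) n m*m∣n*n with gcd[m,n]∣m m n | gcd[m,n]∣n m n
  ... | divides p m≡p*g | divides q n≡q*g = subst (_∣ n) g≡m (gcd[m,n]∣n m n)
    where
    g : ℕ
    g = gcd m n
    instance
      g≢0 : NonZero g
      g≢0 = ≢-nonZero (gcd[m,n]≢0 m n (inj₁ 1+n≢0))
      g*g≢0 : NonZero (g * g)
      g*g≢0 = m*n≢0 g g
    coprime : Coprime p q
    coprime = GCD≡1⇒coprime (GCD-* (subst₂ (λ u v → GCD u v (1 * g)) m≡p*g n≡q*g
                (subst (GCD m n) (sym (*-identityˡ g)) (gcd-GCD m n))))
    rearrange : ∀ x g → (x * g) * (x * g) ≡ (g * g) * (x * x)
    rearrange = solve-∀
    p*p∣q*q : p * p ∣ q * q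
    p*p∣q*q = *-cancelˡ-∣ (g * g) (subst₂ _∣_
                (trans (cong (λ x → x * x) m≡p*g) (rearrange p g))
                (trans (cong (λ x → x * x) n≡q*g) (rearrange q g)) m*m∣n*n)
    p≡1 : p ≡ 1
    p≡1 = coprime (∣-refl , coprime-divisor coprime (∣-trans (m∣m*n p) p*p∣q*q))
    g≡m : g ≡ m
    g≡m = sym (trans m≡p*g (trans (cong (_* g) p≡1) (*-identityˡ g)))

  m^2∣n^2⇒m∣n : ∀ m n → m ^ 2 ∣ n ^ 2 → m ∣ n
  m^2∣n^2⇒m∣n m n = m*m∣n*n⇒m∣n m n ∘ subst₂ _∣_ (square m) (square n)

open import Data.Nat using (ℕ; suc; s≤s; _≤_; _*_; _^_; _<_)
open import Data.Nat.Properties using (*-comm; <-irrefl; n≢0⇒n>0)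
open import Data.Nat.Divisibility using (_∣_; divides)
open import Data.Nat.Tactic.RingSolver using (solve-∀)
open HadamardPairs using (quasiUnbiased-params)
open SquareDivisibility using (square; m^2∣n^2⇒m∣n)

parameter-constraints : ∀ {N l a} → 0 < a →
  a * l ≡ N * N × N ≤ a × (∃ λ α → a ≡ 4 * (α * α)) →
  ∃ λ α → 0 < α × (2 * α) ∣ N × N ≤ 4 * α ^ 2 × l * (2 * α) ^ 2 ≡ N ^ 2 × a ≡ 4 * α ^ 2
parameter-constraints {N} {l} {a} 0<a (al≡N² , N≤a , α , a≡4αα) =
  α , 0<α , 2α∣N , subst (N ≤_) a≡4α² N≤a , l[2α]²≡N² , a≡4α²
  where
  a≡4α² : a ≡ 4 * α ^ 2
  a≡4α² = trans a≡4αα (cong (4 *_) (sym (square α)))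
  l[2α]²≡N² : l * (2 * α) ^ 2 ≡ N ^ 2
  l[2α]²≡N² = begin
    l * (2 * α) ^ 2          ≡⟨ cong (l *_) (square (2 * α)) ⟩
    l * (2 * α * (2 * α))    ≡⟨ cong (l *_) (trans (double-square α) (sym a≡4αα)) ⟩
    l * a                    ≡⟨ *-comm l a ⟩
    a * l                    ≡⟨ al≡N² ⟩
    N * N                    ≡⟨ square N ⟨
    N ^ 2                    ∎
    where
    open ≡-Reasoning
    double-square : ∀ x → 2 * x * (2 * x) ≡ 4 * (x * x)
    double-square = solve-∀
  0<α : 0 < α
  0<α = n≢0⇒n>0 (λ α≡0 → <-irrefl refl (subst (0 <_) (trans a≡4α² (cong (λ x → 4 * x ^ 2) α≡0)) 0<a))
  2α∣N : 2 * α ∣ N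
  2α∣N = m^2∣n^2⇒m∣n (2 * α) N (divides l (sym l[2α]²≡N²))

proposition4p1 : (n : ℕ) → 2 ≤ n → (l a : ℕ) →
    (∃ λ H → ∃ λ K → IsHadamard n H × IsHadamard n K × QuasiUnbiased n l a H K) →
    ∃ λ α → 0 < α × (2 * α) ∣ n × n ≤ 4 * α ^ 2
      × l * (2 * α) ^ 2 ≡ n ^ 2 × a ≡ 4 * α ^ 2
proposition4p1 (suc (suc n)) (s≤s (s≤s _)) l a (H , K , hadH , hadK , qu@(0<a , _)) =
  parameter-constraints 0<a (quasiUnbiased-params n hadH hadK qu)
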